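{- Let $t\geq 0$ and consider the rectangle with $4$ rows and $3t+8$ columns, with unit squares labelled $(i,j)$, $i$ the row counted from the top and $j$ the column counted from the left. Removing a domino from this rectangle yields a region that cannot be tiled by right trominoes if and only if the domino is one of the following pairs: $\{(2,1),(2,2)\}$, $\{(1,2),(2,2)\}$, $\{(2,3t+7),(2,3t+8)\}$, $\{(1,3t+7),(2,3t+7)\}$, $\{(3,1),(3,2)\}$, $\{(3,2),(4,2)\}$, $\{(3,3t+7),(3,3t+8)\}$, $\{(3,3t+7),(4,3t+7)\}$, $\{(2,3),(3,3)\}$, $\{(2,3t+6),(3,3t+6)\}$, $\{(2,3),(2,4)\}$, $\{(2,3t+5),(2,3t+6)\}$, $\{(3,3),(3,4)\}$, $\{(3,3t+5),(3,3t+6)\}$. For every other domino, the remaining region can be tiled by right trominoes.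
   Context: A right tromino is the L-shaped figure formed by three unit squares ($2\times 2$ square minus one unit square), in any rotation. A tiling of a region by right trominoes is a covering by grid-aligned copies with disjoint interiors. A domino is a pair of edge-adjacent unit squares of the rectangle. -}

module Defs where

open import Data.Nat using (ℕ; zero; suc; _+_; _*_; _≤_; _≤ᵇ_; _≡ᵇ_)
open import Data.Bool using (Bool; true; false; _∧_; _∨_; not; if_then_else_)
open import Data.Fin using (Fin; zero; suc)
open import Data.Product using (_×_; _,_; proj₁; proj₂; ∃)
open import Data.Sum using (_⊎_)
open import Data.List using (List; []; _∷_; length; filter; map; sum)
open import Data.List.Relation.Unary.Any using (Any)
open import Relation.Binary.PropositionalEquality using (_≡_)

-- A unit square (i , j): row i (from the top), column j (from the left), 1-based.
Cell : Set
Cell = ℕ × ℕ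

_==ᶜ_ : Cell → Cell → Bool
(i , j) ==ᶜ (k , l) = (i ≡ᵇ k) ∧ (j ≡ᵇ l)

Region : Set
Region = Cell → Bool

InRect : ℕ → Cell → Set
InRect m (i , j) = (1 ≤ i × i ≤ 4) × (1 ≤ j × j ≤ m)

rect : ℕ → Region
rect m (i , j) = (1 ≤ᵇ i) ∧ (i ≤ᵇ 4) ∧ (1 ≤ᵇ j) ∧ (j ≤ᵇ m)

Adjacent : Cell → Cell → Set
Adjacent (i , j) (k , l) =
  (i ≡ k × suc j ≡ l) ⊎ (i ≡ k × suc l ≡ j) ⊎
  (j ≡ l × suc i ≡ k) ⊎ (j ≡ l × suc k ≡ i)

rectMinus : ℕ → Cell → Cell → Region
rectMinus m p q c = rect m c ∧ not (c ==ᶜ p) ∧ not (c ==ᶜ q)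

-- A grid-aligned right tromino: the 2×2 block with top-left square (a , b)
-- minus one of its four squares (selected by the Fin 4), in any of the 4 rotations.
record Tromino : Set where
  constructor tromino
  field
    corner  : Cell
    missing : Fin 4

blockCell : Cell → Fin 4 → Cell
blockCell (a , b) zero                   = (a , b)
blockCell (a , b) (suc zero)             = (a , suc b)
blockCell (a , b) (suc (suc zero))       = (suc a , b)
blockCell (a , b) (suc (suc (suc zero))) = (suc a , suc b)

cells : Tromino → List Cell
cells (tromino c zero)                   = blockCell c (suc zero) ∷ blockCell c (suc (suc zero)) ∷ blockCell c (suc (suc (suc zero))) ∷ []
cells (tromino c (suc zero))             = blockCell c zero ∷ blockCell c (suc (suc zero)) ∷ blockCell c (suc (suc (suc zero))) ∷ []
cells (tromino c (suc (suc zero)))       = blockCell c zero ∷ blockCell c (suc zero) ∷ blockCell c (suc (suc (suc zero))) ∷ []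
cells (tromino c (suc (suc (suc zero)))) = blockCell c zero ∷ blockCell c (suc zero) ∷ blockCell c (suc (suc zero)) ∷ []

covers : Tromino → Cell → Bool
covers τ x = anyC (cells τ)
  where
  anyC : List Cell → Bool
  anyC []       = false
  anyC (y ∷ ys) = (y ==ᶜ x) ∨ anyC ys

coverCount : List Tromino → Cell → ℕ
coverCount []       x = 0
coverCount (τ ∷ ts) x = (if covers τ x then 1 else 0) + coverCount ts x

IsTiling : Region → List Tromino → Set
IsTiling R ts = ∀ x → coverCount ts x ≡ (if R x then 1 else 0)

Tileable : Region → Set
Tileable R = ∃ λ ts → IsTiling R ts

exceptional : ℕ → List (Cell × Cell)
exceptional t =
  ((2 , 1) , (2 , 2)) ∷
  ((1 , 2) , (2 , 2)) ∷
  ((2 , 3 * t + 7) , (2 , 3 * t + 8)) ∷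
  ((1 , 3 * t + 7) , (2 , 3 * t + 7)) ∷
  ((3 , 1) , (3 , 2)) ∷
  ((3 , 2) , (4 , 2)) ∷
  ((3 , 3 * t + 7) , (3 , 3 * t + 8)) ∷
  ((3 , 3 * t + 7) , (4 , 3 * t + 7)) ∷
  ((2 , 3) , (3 , 3)) ∷
  ((2 , 3 * t + 6) , (3 , 3 * t + 6)) ∷
  ((2 , 3) , (2 , 4)) ∷
  ((2 , 3 * t + 5) , (2 , 3 * t + 6)) ∷
  ((3 , 3) , (3 , 4)) ∷
  ((3 , 3 * t + 5) , (3 , 3 * t + 6)) ∷
  []

IsExceptional : ℕ → Cell → Cell → Set
IsExceptional t p q =
  Any (λ d → (p ≡ proj₁ d × q ≡ proj₂ d) ⊎ (p ≡ proj₂ d × q ≡ proj₁ d)) (exceptional t)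

-- A 4 × 3 rectangle is tiled by four trominoes, so a tiling can be lengthened by 4 × 3 blocks on either
-- side.  A domino in the first 8 columns is therefore handled by one explicit tiling of the 4 × 8
-- rectangle minus it, or of the 4 × 11 rectangle for the dominoes that are exceptional only when t = 0;
-- these tilings are checked by computation.  A domino further right is moved 3 columns to the left by
-- cutting off the first 4 × 3 block, which gives an induction on t.  Conversely, a tiling of the region
-- restricts, near the end of the rectangle at which an exceptional domino sits, to a placement of
-- trominoes covering the first (or last) one to three columns, and an exhaustive search shows that no
-- such placement exists.

module Submission where

open import Defs
open import Data.Bool using (Bool; true; false; T; _∧_; _∨_; not; if_then_else_)
open import Data.Bool.ListAction using (all; any)
open import Data.Bool.Properties
  using (T-∧; T-≡; ∧-comm; ∧-identityʳ; ∧-zeroʳ; ∧-conicalˡ; ∧-conicalʳ; ∨-conicalˡ; ∨-conicalʳ;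
         not-injective)
open import Data.Empty using (⊥; ⊥-elim)
open import Data.Fin using (zero; suc; #_)
open import Data.List using (List; []; _∷_; _++_; map; concatMap; upTo; allFin; cartesianProductWith)
open import Data.List.Membership.Propositional using (_∈_; find; lose)
open import Data.List.Membership.Propositional.Properties using (∈-upTo⁺; ∈-allFin; ∈-cartesianProductWith⁺)
open import Data.List.Properties using (map-id)
open import Data.List.Relation.Unary.All as All using (All; []; _∷_)
open import Data.List.Relation.Unary.All.Properties using (all⁺; all⁻)
open import Data.List.Relation.Unary.Any as Any using (Any; here; there; any?)
open import Data.List.Relation.Unary.Any.Properties using (any⁺; any⁻; map⁺; map⁻)
open import Data.Nat
  using (ℕ; zero; suc; pred; _+_; _*_; _≤_; _<_; z≤n; s≤s; _≤ᵇ_; _<ᵇ_; _≡ᵇ_; _≤?_; _≟_)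
open import Data.Nat.Properties
open import Data.Product as Product using (_×_; _,_; proj₁; proj₂; ∃-syntax)
open import Data.Product.Properties using (≡-dec)
open import Data.Sum as Sum using (_⊎_; inj₁; inj₂)
open import Function using (_∘_)
open import Function.Bundles using (_⇔_; mk⇔; module Equivalence)
open import Relation.Binary.PropositionalEquality using (_≡_; refl; sym; trans; cong; cong₂; subst)
open import Relation.Nullary using (¬_; Dec; yes; no)
open import Relation.Nullary.Decidable using (⌊_⌋; decidable-stable; _×-dec_; _⊎-dec_)

open Equivalence using (to; from)

indicator : Bool → ℕ
indicator b = if b then 1 else 0

≡ᵇ-+ : ∀ a m n → (a + m ≡ᵇ a + n) ≡ (m ≡ᵇ n)
≡ᵇ-+ zero    m n = refl
≡ᵇ-+ (suc a) m n = ≡ᵇ-+ a m n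

≤ᵇ-+ : ∀ a m n → (a + m ≤ᵇ a + n) ≡ (m ≤ᵇ n)
≤ᵇ-+ zero    m n = refl
≤ᵇ-+ (suc a) m n = trans (≤ᵇ-suc (a + m) (a + n)) (≤ᵇ-+ a m n)
  where
  ≤ᵇ-suc : ∀ m n → (suc m ≤ᵇ suc n) ≡ (m ≤ᵇ n)
  ≤ᵇ-suc zero    n = refl
  ≤ᵇ-suc (suc m) n = refl

≤ᵇ-true : ∀ {m n} → m ≤ n → (m ≤ᵇ n) ≡ true
≤ᵇ-true m≤n = to T-≡ (≤⇒≤ᵇ m≤n)

≤ᵇ-false : ∀ {m n} → n < m → (m ≤ᵇ n) ≡ false
≤ᵇ-false {m} {n} n<m with m ≤ᵇ n in m≤ᵇn
... | false = refl
... | true  = ⊥-elim (<⇒≱ n<m (≤ᵇ⇒≤ m n (subst T (sym m≤ᵇn) _)))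

T-not⁺ : ∀ {b} → ¬ T b → T (not b)
T-not⁺ {false} _   = _
T-not⁺ {true}  ¬tt = ¬tt _

T-not⁻ : ∀ {b} → T (not b) → ¬ T b
T-not⁻ {false} _ ()

==ᶜ⇒≡ : ∀ {x y} → T (x ==ᶜ y) → x ≡ y
==ᶜ⇒≡ {i , j} {k , l} h =
  cong₂ _,_ (≡ᵇ⇒≡ i k (proj₁ (to T-∧ h))) (≡ᵇ⇒≡ j l (proj₂ (to T-∧ h)))

==ᶜ-refl : ∀ x → T (x ==ᶜ x)
==ᶜ-refl (i , j) = from T-∧ (≡⇒≡ᵇ i i refl , ≡⇒≡ᵇ j j refl)

shiftCell : ℕ → Cell → Cell
shiftCell a (i , j) = (i , a + j)

==ᶜ-shiftCell : ∀ a x y → (shiftCell a x ==ᶜ shiftCell a y) ≡ (x ==ᶜ y)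
==ᶜ-shiftCell a (i , j) (k , l) = cong ((i ≡ᵇ k) ∧_) (≡ᵇ-+ a j l)

avoids : Cell → Cell → Cell → Bool
avoids p q x = not (x ==ᶜ p) ∧ not (x ==ᶜ q)

minus : Region → Cell → Cell → Region
minus R p q x = R x ∧ avoids p q x

avoids-false : ∀ p q x → avoids p q x ≡ false → x ≡ p ⊎ x ≡ q
avoids-false p q x h with x ==ᶜ p in e₁ | x ==ᶜ q in e₂
... | true  | _    = inj₁ (==ᶜ⇒≡ (subst T (sym e₁) _))
... | false | true = inj₂ (==ᶜ⇒≡ (subst T (sym e₂) _))

strip : (ℕ → Bool) → Region
strip inColumns (i , j) = (1 ≤ᵇ i) ∧ (i ≤ᵇ 4) ∧ inColumns j

strip-mono : ∀ f g i j j′ → (T (f j) → T (g j′)) → T (strip f (i , j)) → T (strip g (i , j′))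
strip-mono f g i j j′ f⇒g inStrip =
  let row₁ , rest = to (T-∧ {1 ≤ᵇ i}) inStrip
      row₄ , col  = to (T-∧ {i ≤ᵇ 4}) rest
  in from T-∧ (row₁ , from T-∧ (row₄ , f⇒g col))

minus-mono : ∀ R S p q x → (T (R x) → T (S x)) → T (minus R p q x) → T (minus S p q x)
minus-mono R S p q x R⇒S inMinus =
  let inR , avoid = to (T-∧ {R x}) inMinus in from T-∧ (R⇒S inR , avoid)

minus-shiftCell : ∀ n R p q y →
  minus R (shiftCell n p) (shiftCell n q) (shiftCell n y) ≡ minus (R ∘ shiftCell n) p q y
minus-shiftCell n R p q y =
  cong₂ (λ u v → R (shiftCell n y) ∧ not u ∧ not v) (==ᶜ-shiftCell n y p) (==ᶜ-shiftCell n y q)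

shiftRegion : ℕ → Region → Region
shiftRegion zero    R x           = R x
shiftRegion (suc a) R (i , zero)  = false
shiftRegion (suc a) R (i , suc j) = shiftRegion a R (i , j)

shiftRegion-+ : ∀ a R i j → shiftRegion a R (i , a + j) ≡ R (i , j)
shiftRegion-+ zero    R i j = refl
shiftRegion-+ (suc a) R i j = shiftRegion-+ a R i j

shiftRegion-low : ∀ a R → (∀ i → R (i , 0) ≡ false) →
                  ∀ i {j} → j ≤ a → shiftRegion a R (i , j) ≡ false
shiftRegion-low zero    R col0 i z≤n       = col0 i
shiftRegion-low (suc a) R col0 i {zero}  _ = refl
shiftRegion-low (suc a) R col0 i {suc j} (s≤s j≤a) = shiftRegion-low a R col0 i j≤a

shiftRegion-minus : ∀ a R p q x →
  shiftRegion a (minus R p q) x ≡ minus (shiftRegion a R) (shiftCell a p) (shiftCell a q) x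
shiftRegion-minus zero    R (_ , _) (_ , _) x = refl
shiftRegion-minus (suc a) R p q (i , zero)  = refl
shiftRegion-minus (suc a) R p q (i , suc j) = shiftRegion-minus a R p q (i , j)

rect-columnFalse : ∀ m i j → (1 ≤ᵇ j) ∧ (j ≤ᵇ m) ≡ false → rect m (i , j) ≡ false
rect-columnFalse m i j h rewrite h | ∧-zeroʳ (i ≤ᵇ 4) = ∧-zeroʳ (1 ≤ᵇ i)

rect-col0 : ∀ m i → rect m (i , 0) ≡ false
rect-col0 m i = rect-columnFalse m i 0 refl

rect-beyond : ∀ a i {j} → 1 ≤ j → rect a (i , a + j) ≡ false
rect-beyond a i {j} 1≤j =
  rect-columnFalse a i (a + j) (trans (cong ((1 ≤ᵇ a + j) ∧_) (≤ᵇ-false (m<m+n a 1≤j))) (∧-zeroʳ _))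

rect⇒InRect : ∀ {m i j} → T (rect m (i , j)) → InRect m (i , j)
rect⇒InRect {m} {i} {j} h =
  let 1≤i , h′  = to (T-∧ {1 ≤ᵇ i}) h
      i≤4 , h″  = to (T-∧ {i ≤ᵇ 4}) h′
      1≤j , j≤m = to (T-∧ {1 ≤ᵇ j}) h″
  in (≤ᵇ⇒≤ 1 i 1≤i , ≤ᵇ⇒≤ i 4 i≤4) , (≤ᵇ⇒≤ 1 j 1≤j , ≤ᵇ⇒≤ j m j≤m)

rect-inBox : ∀ {m i j} → T (rect m (i , j)) → i ≤ 4 × j ≤ m
rect-inBox h = let (_ , i≤4) , (_ , j≤m) = rect⇒InRect h in i≤4 , j≤m

InRect⇒rect : ∀ {m i j} → InRect m (i , j) → T (rect m (i , j))
InRect⇒rect ((1≤i , i≤4) , (1≤j , j≤m)) =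
  from T-∧ (≤⇒≤ᵇ 1≤i , from T-∧ (≤⇒≤ᵇ i≤4 , from T-∧ (≤⇒≤ᵇ 1≤j , ≤⇒≤ᵇ j≤m)))

rectMinus⇒rect : ∀ W p q x → T (rectMinus W p q x) → T (rect W x)
rectMinus⇒rect W p q x = proj₁ ∘ to (T-∧ {rect W x})

rectMinus-column : ∀ W p q i c → T (rectMinus W p q (i , c)) → 1 ≤ c
rectMinus-column W p q i c = proj₁ ∘ proj₂ ∘ rect⇒InRect {W} {i} {c} ∘ rectMinus⇒rect W p q (i , c)

rectMinus-comm : ∀ m p q x → rectMinus m p q x ≡ rectMinus m q p x
rectMinus-comm m p q x = cong (rect m x ∧_) (∧-comm (not (x ==ᶜ p)) (not (x ==ᶜ q)))

rect-+-low : ∀ a b i {j} → j ≤ a → rect (a + b) (i , j) ≡ rect a (i , j)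
rect-+-low a b i j≤a rewrite ≤ᵇ-true (≤-trans j≤a (m≤m+n a b)) | ≤ᵇ-true j≤a = refl

rect-+-high : ∀ a b i k → rect (a + b) (i , a + suc k) ≡ rect b (i , suc k)
rect-+-high a b i k rewrite ≤ᵇ-true (≤-trans (s≤s z≤n) (m≤n+m (suc k) a)) | ≤ᵇ-+ a (suc k) b = refl

columnSplit : ∀ a j → j ≤ a ⊎ ∃[ k ] j ≡ a + suc k
columnSplit a j with j ≤? a
... | yes j≤a = inj₁ j≤a
... | no  j≰a =
  let k , a+1+k≡j = m≤n⇒∃[o]m+o≡n (≰⇒> j≰a) in inj₂ (k , trans (sym a+1+k≡j) (sym (+-suc a k)))

DisjointUnion : Region → Region → Region → Set
DisjointUnion R R₁ R₂ = ∀ x → indicator (R x) ≡ indicator (R₁ x) + indicator (R₂ x)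

rect-+ : ∀ a b → DisjointUnion (rect (a + b)) (rect a) (shiftRegion a (rect b))
rect-+ a b (i , j) with columnSplit a j
... | inj₁ j≤a
  rewrite rect-+-low a b i j≤a | shiftRegion-low a (rect b) (rect-col0 b) i j≤a = sym (+-identityʳ _)
... | inj₂ (k , refl)
  rewrite rect-+-high a b i k | rect-beyond a i {suc k} (s≤s z≤n) | shiftRegion-+ a (rect b) i (suc k) = refl

minus-unionˡ : ∀ {R R₁ R₂} p q → DisjointUnion R R₁ R₂ → R₂ p ≡ false → R₂ q ≡ false →
               DisjointUnion (minus R p q) (minus R₁ p q) R₂
minus-unionˡ {R} {R₁} p q union p∉R₂ q∉R₂ x with avoids p q x in avoid
... | true rewrite ∧-identityʳ (R x) | ∧-identityʳ (R₁ x) = union x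
... | false rewrite ∧-zeroʳ (R x) | ∧-zeroʳ (R₁ x) with avoids-false p q x avoid
...   | inj₁ refl rewrite p∉R₂ = refl
...   | inj₂ refl rewrite q∉R₂ = refl

minus-unionʳ : ∀ {R R₁ R₂} p q → DisjointUnion R R₁ R₂ → R₁ p ≡ false → R₁ q ≡ false →
               DisjointUnion (minus R p q) R₁ (minus R₂ p q)
minus-unionʳ {R} {R₁} {R₂} p q union p∉R₁ q∉R₁ x with avoids p q x in avoid
... | true rewrite ∧-identityʳ (R x) | ∧-identityʳ (R₂ x) = union x
... | false rewrite ∧-zeroʳ (R x) | ∧-zeroʳ (R₂ x) with avoids-false p q x avoid
...   | inj₁ refl rewrite p∉R₁ = refl
...   | inj₂ refl rewrite q∉R₁ = refl

rectMinus-+ˡ : ∀ a b p q → proj₂ p ≤ a → proj₂ q ≤ a →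
               DisjointUnion (rectMinus (a + b) p q) (rectMinus a p q) (shiftRegion a (rect b))
rectMinus-+ˡ a b p q p≤a q≤a =
  minus-unionˡ {rect (a + b)} {rect a} p q (rect-+ a b)
    (shiftRegion-low a (rect b) (rect-col0 b) (proj₁ p) p≤a)
    (shiftRegion-low a (rect b) (rect-col0 b) (proj₁ q) q≤a)

rectMinus-+ʳ : ∀ a b p q → 1 ≤ proj₂ p → 1 ≤ proj₂ q →
               DisjointUnion (rectMinus (a + b) (shiftCell a p) (shiftCell a q)) (rect a)
                             (shiftRegion a (rectMinus b p q))
rectMinus-+ʳ a b p q 1≤p 1≤q x =
  trans (minus-unionʳ {rect (a + b)} {rect a} {shiftRegion a (rect b)} (shiftCell a p) (shiftCell a q)
           (rect-+ a b) (rect-beyond a (proj₁ p) 1≤p) (rect-beyond a (proj₁ q) 1≤q) x)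
        (cong (λ c → indicator (rect a x) + indicator c) (sym (shiftRegion-minus a (rect b) p q x)))

shiftTromino : ℕ → Tromino → Tromino
shiftTromino a (tromino c k) = tromino (shiftCell a c) k

covers-shift-suc : ∀ a τ i j → covers (shiftTromino (suc a) τ) (i , suc j) ≡ covers (shiftTromino a τ) (i , j)
covers-shift-suc a (tromino (r , b) zero)                   i j = refl
covers-shift-suc a (tromino (r , b) (suc zero))             i j = refl
covers-shift-suc a (tromino (r , b) (suc (suc zero)))       i j = refl
covers-shift-suc a (tromino (r , b) (suc (suc (suc zero)))) i j = refl

covers-shift-col0 : ∀ a τ i → covers (shiftTromino (suc a) τ) (i , zero) ≡ false
covers-shift-col0 a (tromino (r , b) zero) i
  rewrite ∧-zeroʳ (r ≡ᵇ i) | ∧-zeroʳ (suc r ≡ᵇ i) = refl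
covers-shift-col0 a (tromino (r , b) (suc zero)) i
  rewrite ∧-zeroʳ (r ≡ᵇ i) | ∧-zeroʳ (suc r ≡ᵇ i) = refl
covers-shift-col0 a (tromino (r , b) (suc (suc zero))) i
  rewrite ∧-zeroʳ (r ≡ᵇ i) | ∧-zeroʳ (suc r ≡ᵇ i) = refl
covers-shift-col0 a (tromino (r , b) (suc (suc (suc zero)))) i
  rewrite ∧-zeroʳ (r ≡ᵇ i) | ∧-zeroʳ (suc r ≡ᵇ i) = refl

covers-shift-zero : ∀ τ x → covers (shiftTromino 0 τ) x ≡ covers τ x
covers-shift-zero (tromino (r , b) k) x = refl

covers-shift : ∀ a τ y → covers (shiftTromino a τ) (shiftCell a y) ≡ covers τ y
covers-shift zero    τ (i , j) = covers-shift-zero τ (i , j)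
covers-shift (suc a) τ (i , j) = trans (covers-shift-suc a τ i (a + j)) (covers-shift a τ (i , j))

covers-any : ∀ τ x → covers τ x ≡ any (_==ᶜ x) (cells τ)
covers-any (tromino c zero)                   x = refl
covers-any (tromino c (suc zero))             x = refl
covers-any (tromino c (suc (suc zero)))       x = refl
covers-any (tromino c (suc (suc (suc zero)))) x = refl

covers⇒∈ : ∀ τ {x} → T (covers τ x) → x ∈ cells τ
covers⇒∈ τ {x} h = Any.map (sym ∘ ==ᶜ⇒≡) (any⁻ (_==ᶜ x) (cells τ) (subst T (covers-any τ x) h))

∈⇒covers : ∀ τ {x} → x ∈ cells τ → T (covers τ x)
∈⇒covers τ {x} x∈τ =
  subst T (sym (covers-any τ x)) (any⁺ (_==ᶜ x) (Any.map (λ { refl → ==ᶜ-refl x }) x∈τ))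

InBlock : Cell → Cell → Set
InBlock (r , b) (i , j) = (r ≡ i ⊎ suc r ≡ i) × (b ≡ j ⊎ suc b ≡ j)

cells-inBlock : ∀ c k → All (InBlock c) (cells (tromino c k))
cells-inBlock c zero =
  (inj₁ refl , inj₂ refl) ∷ (inj₂ refl , inj₁ refl) ∷ (inj₂ refl , inj₂ refl) ∷ []
cells-inBlock c (suc zero) =
  (inj₁ refl , inj₁ refl) ∷ (inj₂ refl , inj₁ refl) ∷ (inj₂ refl , inj₂ refl) ∷ []
cells-inBlock c (suc (suc zero)) =
  (inj₁ refl , inj₁ refl) ∷ (inj₁ refl , inj₂ refl) ∷ (inj₂ refl , inj₂ refl) ∷ []
cells-inBlock c (suc (suc (suc zero))) =
  (inj₁ refl , inj₁ refl) ∷ (inj₁ refl , inj₂ refl) ∷ (inj₂ refl , inj₁ refl) ∷ []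

covers-inBlock : ∀ c k {x} → T (covers (tromino c k) x) → InBlock c x
covers-inBlock c k h = All.lookup (cells-inBlock c k) (covers⇒∈ (tromino c k) h)

inBlock-≤ : ∀ {r b i j} → InBlock (r , b) (i , j) → i ≤ suc r × j ≤ suc b
inBlock-≤ (i≈r , j≈b) = bound i≈r , bound j≈b
  where
  bound : ∀ {m n} → m ≡ n ⊎ suc m ≡ n → n ≤ suc m
  bound (inj₁ refl) = n≤1+n _
  bound (inj₂ refl) = ≤-refl

coverCount-++ : ∀ ts us x → coverCount (ts ++ us) x ≡ coverCount ts x + coverCount us x
coverCount-++ []       us x = refl
coverCount-++ (τ ∷ ts) us x =
  trans (cong (indicator (covers τ x) +_) (coverCount-++ ts us x)) (sym (+-assoc (indicator (covers τ x)) _ _))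

coverCount-map : ∀ {A : Set} (f g : A → Tromino) ts x y → (∀ τ → covers (f τ) x ≡ covers (g τ) y) →
                 coverCount (map f ts) x ≡ coverCount (map g ts) y
coverCount-map f g []       x y eq = refl
coverCount-map f g (τ ∷ ts) x y eq = cong₂ _+_ (cong indicator (eq τ)) (coverCount-map f g ts x y eq)

coverCount-none : ∀ {A : Set} (f : A → Tromino) ts x → (∀ τ → covers (f τ) x ≡ false) →
                  coverCount (map f ts) x ≡ 0
coverCount-none f []       x none = refl
coverCount-none f (τ ∷ ts) x none rewrite none τ = coverCount-none f ts x none

IsTiling-++ : ∀ {R R₁ R₂ ts us} → IsTiling R₁ ts → IsTiling R₂ us → DisjointUnion R R₁ R₂ →
              IsTiling R (ts ++ us)
IsTiling-++ {ts = ts} {us} tiles₁ tiles₂ union x =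
  trans (coverCount-++ ts us x) (trans (cong₂ _+_ (tiles₁ x) (tiles₂ x)) (sym (union x)))

IsTiling-resp : ∀ {R S ts} → (∀ x → R x ≡ S x) → IsTiling R ts → IsTiling S ts
IsTiling-resp R≗S tiles x = trans (tiles x) (cong indicator (R≗S x))

IsTiling-shift : ∀ a {R ts} → IsTiling R ts → IsTiling (shiftRegion a R) (map (shiftTromino a) ts)
IsTiling-shift zero {ts = ts} tiles x =
  trans (coverCount-map (shiftTromino 0) (λ τ → τ) ts x x (λ τ → covers-shift-zero τ x))
        (trans (cong (λ us → coverCount us x) (map-id ts)) (tiles x))
IsTiling-shift (suc a) {ts = ts} tiles (i , zero) =
  coverCount-none (shiftTromino (suc a)) ts (i , zero) (λ τ → covers-shift-col0 a τ i)
IsTiling-shift (suc a) {ts = ts} tiles (i , suc j) =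
  trans (coverCount-map (shiftTromino (suc a)) (shiftTromino a) ts (i , suc j) (i , j)
                        (λ τ → covers-shift-suc a τ i j))
        (IsTiling-shift a {ts = ts} tiles (i , j))

Tileable-resp : ∀ {R S} → (∀ x → R x ≡ S x) → Tileable R → Tileable S
Tileable-resp R≗S (ts , tiles) = ts , IsTiling-resp {ts = ts} R≗S tiles

Tileable-beside : ∀ a {R R₁ R₂} → Tileable R₁ → Tileable R₂ → DisjointUnion R R₁ (shiftRegion a R₂) →
                  Tileable R
Tileable-beside a (ts , tiles₁) (us , tiles₂) union =
  ts ++ map (shiftTromino a) us ,
  IsTiling-++ {ts = ts} tiles₁ (IsTiling-shift a {ts = us} tiles₂) union

Tileable-extendʳ : ∀ {a b p q} → proj₂ p ≤ a → proj₂ q ≤ a →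
                   Tileable (rectMinus a p q) → Tileable (rect b) → Tileable (rectMinus (a + b) p q)
Tileable-extendʳ {a} {b} {p} {q} p≤a q≤a left right =
  Tileable-beside a left right (rectMinus-+ˡ a b p q p≤a q≤a)

Tileable-extendˡ : ∀ {a b p q} → 1 ≤ proj₂ p → 1 ≤ proj₂ q → Tileable (rect a) → Tileable (rectMinus b p q) →
                   Tileable (rectMinus (a + b) (shiftCell a p) (shiftCell a q))
Tileable-extendˡ {a} {b} {p} {q} 1≤p 1≤q left right =
  Tileable-beside a left right (rectMinus-+ʳ a b p q 1≤p 1≤q)

coverCount-pos : ∀ ts {σ x} → σ ∈ ts → T (covers σ x) → 1 ≤ coverCount ts x
coverCount-pos (τ ∷ ts) {x = x} (here refl) covered with covers τ x
... | true = s≤s z≤n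
coverCount-pos (τ ∷ ts) {x = x} (there σ∈ts) covered =
  ≤-trans (coverCount-pos ts σ∈ts covered) (m≤n+m _ (indicator (covers τ x)))

coverCount-pos⇒∈ : ∀ ts x → 1 ≤ coverCount ts x → ∃[ σ ] σ ∈ ts × T (covers σ x)
coverCount-pos⇒∈ (τ ∷ ts) x pos with covers τ x in covered
... | true  = τ , here refl , subst T (sym covered) _
... | false = let σ , σ∈ts , σ-covers = coverCount-pos⇒∈ ts x pos in σ , there σ∈ts , σ-covers

coverCount≤1⇒unique : ∀ ts {σ τ x} → coverCount ts x ≤ 1 → σ ∈ ts → τ ∈ ts →
                       T (covers σ x) → T (covers τ x) → σ ≡ τ
coverCount≤1⇒unique (υ ∷ ts) ≤1 (here refl) (here refl) _ _ = refl
coverCount≤1⇒unique (υ ∷ ts) {x = x} ≤1 (here refl) (there τ∈ts) σ-covers τ-covers with covers υ x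
... | true = ⊥-elim (1+n≰n (≤-trans (s≤s (coverCount-pos ts τ∈ts τ-covers)) ≤1))
coverCount≤1⇒unique (υ ∷ ts) {x = x} ≤1 (there σ∈ts) (here refl) σ-covers τ-covers with covers υ x
... | true = ⊥-elim (1+n≰n (≤-trans (s≤s (coverCount-pos ts σ∈ts σ-covers)) ≤1))
coverCount≤1⇒unique (υ ∷ ts) {x = x} ≤1 (there σ∈ts) (there τ∈ts) =
  coverCount≤1⇒unique ts (≤-trans (m≤n+m _ (indicator (covers υ x))) ≤1) σ∈ts τ∈ts

module _ {R ts} (tiles : IsTiling R ts) where

  tiling-covers : ∀ {x} → T (R x) → ∃[ σ ] σ ∈ ts × T (covers σ x)
  tiling-covers {x} x∈R = coverCount-pos⇒∈ ts x (subst (1 ≤_) (sym (tiles x)) (inside x∈R))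
    where
    inside : ∀ {b} → T b → 1 ≤ indicator b
    inside {true} _ = s≤s z≤n

  tiling-inside : ∀ {σ x} → σ ∈ ts → T (covers σ x) → T (R x)
  tiling-inside {x = x} σ∈ts covered = positive (subst (1 ≤_) (tiles x) (coverCount-pos ts σ∈ts covered))
    where
    positive : ∀ {b} → 1 ≤ indicator b → T b
    positive {true} _ = _

  tiling-unique : ∀ {σ τ x} → σ ∈ ts → τ ∈ ts → T (covers σ x) → T (covers τ x) → σ ≡ τ
  tiling-unique {x = x} = coverCount≤1⇒unique ts (subst (_≤ 1) (sym (tiles x)) (atMostOne (R x)))
    where
    atMostOne : ∀ b → indicator b ≤ 1
    atMostOne true  = ≤-refl
    atMostOne false = z≤n

-- Tilings certified by computation

boxCells : ℕ → ℕ → List Cell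
boxCells H W = cartesianProductWith _,_ (upTo (suc H)) (upTo (suc W))

∈-boxCells : ∀ {H W i j} → i ≤ H → j ≤ W → (i , j) ∈ boxCells H W
∈-boxCells i≤H j≤W = ∈-cartesianProductWith⁺ _,_ (∈-upTo⁺ (s≤s i≤H)) (∈-upTo⁺ (s≤s j≤W))

withinBox : ℕ → ℕ → Tromino → Bool
withinBox H W (tromino (r , b) k) = (suc r ≤ᵇ H) ∧ (suc b ≤ᵇ W)

checkTiling : ℕ → ℕ → Region → List Tromino → Bool
checkTiling H W R ts =
  all (λ x → coverCount ts x ≡ᵇ indicator (R x)) (boxCells H W) ∧ all (withinBox H W) ts

covers-withinBox : ∀ {H W i j} τ → T (withinBox H W τ) → T (covers τ (i , j)) → i ≤ H × j ≤ W
covers-withinBox {H} {W} (tromino (r , b) k) inBox covered =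
  let i≤r+1 , j≤b+1 = inBlock-≤ (covers-inBlock (r , b) k covered)
      r+1≤H , b+1≤W = to (T-∧ {suc r ≤ᵇ H}) inBox
  in ≤-trans i≤r+1 (≤ᵇ⇒≤ _ _ r+1≤H) , ≤-trans j≤b+1 (≤ᵇ⇒≤ _ _ b+1≤W)

coverCount-outside : ∀ {H W i j} ts → T (all (withinBox H W) ts) → H < i ⊎ W < j → coverCount ts (i , j) ≡ 0
coverCount-outside []       _      _   = refl
coverCount-outside {H} {W} {i} {j} (τ ∷ ts) within out
  with inBox , rest ← to (T-∧ {withinBox H W τ}) within
     | covers τ (i , j) in covered
... | false = coverCount-outside ts rest out
... | true  with covers-withinBox τ inBox (subst T (sym covered) _) | out
...   | i≤H , _ | inj₁ H<i = ⊥-elim (<⇒≱ H<i i≤H)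
...   | _ , j≤W | inj₂ W<j = ⊥-elim (<⇒≱ W<j j≤W)

outsideBox : ∀ {H W i j} → ¬ (i ≤ H × j ≤ W) → H < i ⊎ W < j
outsideBox {H} {W} {i} {j} ¬inBox with i ≤? H
... | no  i≰H = inj₁ (≰⇒> i≰H)
... | yes i≤H = inj₂ (≰⇒> (λ j≤W → ¬inBox (i≤H , j≤W)))

checkTiling-sound : ∀ {H W R} ts → T (checkTiling H W R ts) →
                    (∀ {i j} → T (R (i , j)) → i ≤ H × j ≤ W) → IsTiling R ts
checkTiling-sound {H} {W} {R} ts ok R⊆box (i , j)
  with counts , within ← to (T-∧ {all _ (boxCells H W)}) ok
     | i ≤? H ×-dec j ≤? W
... | yes (i≤H , j≤W) = ≡ᵇ⇒≡ _ _ (All.lookup (all⁺ _ (boxCells H W) counts) (∈-boxCells i≤H j≤W))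
... | no ¬inBox with R (i , j) in inR
...   | true  = ⊥-elim (¬inBox (R⊆box (subst T (sym inR) _)))
...   | false = coverCount-outside ts within (outsideBox ¬inBox)

rect3Tiling : List Tromino
rect3Tiling = tromino (1 , 1) (# 1) ∷ tromino (3 , 1) (# 1) ∷ tromino (1 , 2) (# 2) ∷ tromino (3 , 2) (# 2) ∷ []

rect-3*-tileable : ∀ t → Tileable (rect (3 * t))
rect-3*-tileable zero    = [] , checkTiling-sound [] _ rect-inBox
rect-3*-tileable (suc t) =
  subst (Tileable ∘ rect) (sym (*-suc 3 t))
        (Tileable-beside 3 (rect3Tiling , checkTiling-sound rect3Tiling _ rect-inBox)
                           (rect-3*-tileable t) (rect-+ 3 (3 * t)))

-- Local obstructions

coveredBy : List Tromino → Cell → Bool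
coveredBy C y = any (λ τ → covers τ y) C

fitsIn : Region → List Tromino → Tromino → Bool
fitsIn L C σ = all (λ y → L y ∧ not (coveredBy C y)) (cells σ)

nearby : ℕ → List ℕ
nearby n = n ∷ pred n ∷ []

candidates : Cell → List Tromino
candidates (i , j) = cartesianProductWith tromino (cartesianProductWith _,_ (nearby i) (nearby j)) (allFin 4)

-- Whether the trominoes C placed so far can be extended, by trominoes inside L avoiding C, so as to
-- cover every cell of xs that lies in N.
extendable : Region → Region → List Cell → List Tromino → Bool
extendable L N []       C = true
extendable L N (x ∷ xs) C =
  if coveredBy C x ∨ not (N x) then extendable L N xs C
  else any (λ σ → covers σ x ∧ fitsIn L C σ ∧ extendable L N xs (σ ∷ C)) (candidates x)

nearby-row : ∀ {r i} → r ≡ i ⊎ suc r ≡ i → r ∈ nearby i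
nearby-row (inj₁ refl) = here refl
nearby-row (inj₂ refl) = there (here refl)

nearby-column : ∀ s {b c} → 1 ≤ c → b ≡ s + c ⊎ suc b ≡ s + c →
                ∃[ c′ ] c′ ∈ nearby c × s + c′ ≡ b
nearby-column s {c = c}     _ (inj₁ refl) = c , here refl , refl
nearby-column s {c = suc c} _ (inj₂ eq)   = c , there (here refl) , suc-injective (trans (sym (+-suc s c)) (sym eq))

shifted-candidate : ∀ s σ {i c} → 1 ≤ c → T (covers σ (i , s + c)) →
                    ∃[ σ′ ] σ′ ∈ candidates (i , c) × shiftTromino s σ′ ≡ σ
shifted-candidate s (tromino (r , b) k) 1≤c covered =
  let rows , columns = covers-inBlock (r , b) k covered
      c′ , c′∈ , s+c′≡b = nearby-column s 1≤c columns
  in tromino (r , c′) k ,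
     ∈-cartesianProductWith⁺ tromino (∈-cartesianProductWith⁺ _,_ (nearby-row rows) c′∈) (∈-allFin k) ,
     cong (λ b → tromino (r , b) k) s+c′≡b

-- A tiling of R, read through the window shifted by s, supplies the placements that extendable looks for.
module _ {R ts} (tiles : IsTiling R ts) (s : ℕ) {L N : Region}
         (R⊆L : ∀ y → T (R (shiftCell s y)) → T (L y))
         (N⊆R : ∀ y → T (N y) → T (R (shiftCell s y)))
         (N-column : ∀ i c → T (N (i , c)) → 1 ≤ c) where

  Placed : List Tromino → Set
  Placed C = ∀ {τ} → τ ∈ C → shiftTromino s τ ∈ ts

  extendable-complete : ∀ xs C → Placed C → T (extendable L N xs C)
  extendable-complete []             C placed = _
  extendable-complete ((i , c) ∷ xs) C placed with coveredBy C (i , c) ∨ not (N (i , c)) in skip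
  ... | true  = extendable-complete xs C placed
  ... | false =
    any⁺ (λ σ → covers σ (i , c) ∧ fitsIn L C σ ∧ extendable L N xs (σ ∷ C)) (lose σ′∈ (from T-∧
      (σ′-covers-x , from T-∧ (σ′-fits , extendable-complete xs (σ′ ∷ C) placed′))))
    where
    x-covered : coveredBy C (i , c) ≡ false
    x-covered = ∨-conicalˡ _ _ skip

    x∈N : T (N (i , c))
    x∈N = subst T (sym (not-injective (∨-conicalʳ _ _ skip))) _

    tile : ∃[ σ ] σ ∈ ts × T (covers σ (i , s + c))
    tile = tiling-covers tiles (N⊆R (i , c) x∈N)

    σ : Tromino
    σ = proj₁ tile

    σ∈ts : σ ∈ ts
    σ∈ts = proj₁ (proj₂ tile)

    σ-covers-x : T (covers σ (i , s + c))
    σ-covers-x = proj₂ (proj₂ tile)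

    candidate : ∃[ σ′ ] σ′ ∈ candidates (i , c) × shiftTromino s σ′ ≡ σ
    candidate = shifted-candidate s σ (N-column i c x∈N) σ-covers-x

    σ′ : Tromino
    σ′ = proj₁ candidate

    σ′∈ : σ′ ∈ candidates (i , c)
    σ′∈ = proj₁ (proj₂ candidate)

    σ′-shifted : shiftTromino s σ′ ≡ σ
    σ′-shifted = proj₂ (proj₂ candidate)

    σ′-covers : ∀ y → covers σ′ y ≡ covers σ (shiftCell s y)
    σ′-covers y = trans (sym (covers-shift s σ′ y)) (cong (λ τ → covers τ (shiftCell s y)) σ′-shifted)

    σ′-covers-x : T (covers σ′ (i , c))
    σ′-covers-x = subst T (sym (σ′-covers (i , c))) σ-covers-x

    -- A placed tromino covering a cell of σ′ would equal σ after the shift, hence cover x.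
    uncovered : ∀ {y} → T (covers σ′ y) → ¬ T (coveredBy C y)
    uncovered {y} σ′-covers-y y-covered =
      let τ , τ∈C , τ-covers-y = find (any⁻ (λ τ → covers τ y) C y-covered)
          τ≡σ = tiling-unique tiles (placed τ∈C) σ∈ts
                  (subst T (sym (covers-shift s τ y)) τ-covers-y) (subst T (σ′-covers y) σ′-covers-y)
          τ-covers-x = subst T (trans (sym (cong (λ υ → covers υ (i , s + c)) τ≡σ)) (covers-shift s τ (i , c)))
                               σ-covers-x
      in subst T x-covered (any⁺ (λ τ → covers τ (i , c)) (lose τ∈C τ-covers-x))

    σ′-fits : T (fitsIn L C σ′)
    σ′-fits = all⁻ (λ y → L y ∧ not (coveredBy C y)) (All.tabulate λ {y} y∈σ′ →
      let σ′-covers-y = ∈⇒covers σ′ y∈σ′ in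
      from T-∧ (R⊆L y (tiling-inside tiles σ∈ts (subst T (σ′-covers y) σ′-covers-y)) ,
                T-not⁺ (uncovered σ′-covers-y)))

    placed′ : Placed (σ′ ∷ C)
    placed′ (here refl)  = subst (_∈ ts) (sym σ′-shifted) σ∈ts
    placed′ (there τ∈C) = placed τ∈C

  untileable-by-search : ∀ xs → T (not (extendable L N xs [])) → ⊥
  untileable-by-search xs fails = T-not⁻ fails (extendable-complete xs [] (λ ()))

untileable-atLeft : ∀ n {W} p q xs →
  T (not (extendable (minus (strip (1 ≤ᵇ_)) p q) (rectMinus W p q) xs [])) →
  ¬ Tileable (rectMinus (n + W) p q)
untileable-atLeft n {W} p q xs fails (ts , tiles) =
  untileable-by-search {ts = ts} tiles 0 R⊆L N⊆R (rectMinus-column W p q) xs fails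
  where
  R⊆L : ∀ y → T (rectMinus (n + W) p q y) → T (minus (strip (1 ≤ᵇ_)) p q y)
  R⊆L (i , j) = minus-mono (rect (n + W)) (strip (1 ≤ᵇ_)) p q (i , j)
                  (strip-mono (λ j → (1 ≤ᵇ j) ∧ (j ≤ᵇ n + W)) (1 ≤ᵇ_) i j j (proj₁ ∘ to (T-∧ {1 ≤ᵇ j})))
  N⊆R : ∀ y → T (rectMinus W p q y) → T (rectMinus (n + W) p q y)
  N⊆R (i , j) = minus-mono (rect W) (rect (n + W)) p q (i , j)
                  (strip-mono (λ j → (1 ≤ᵇ j) ∧ (j ≤ᵇ W)) (λ j → (1 ≤ᵇ j) ∧ (j ≤ᵇ n + W)) i j j widen)
    where
    widen : T ((1 ≤ᵇ j) ∧ (j ≤ᵇ W)) → T ((1 ≤ᵇ j) ∧ (j ≤ᵇ n + W))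
    widen h = let 1≤j , j≤W = to (T-∧ {1 ≤ᵇ j}) h
              in from T-∧ (1≤j , ≤⇒≤ᵇ (≤-trans (≤ᵇ⇒≤ j W j≤W) (m≤n+m W n)))

untileable-atRight : ∀ n {W} p q xs →
  T (not (extendable (minus (strip (_≤ᵇ W)) p q) (rectMinus W p q) xs [])) →
  ¬ Tileable (rectMinus (n + W) (shiftCell n p) (shiftCell n q))
untileable-atRight n {W} p q xs fails (ts , tiles) =
  untileable-by-search {ts = ts} tiles n R⊆L N⊆R (rectMinus-column W p q) xs fails
  where
  R⊆L : ∀ y → T (rectMinus (n + W) (shiftCell n p) (shiftCell n q) (shiftCell n y)) →
                T (minus (strip (_≤ᵇ W)) p q y)
  R⊆L (i , c) = minus-mono (rect (n + W) ∘ shiftCell n) (strip (_≤ᵇ W)) p q (i , c)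
                  (strip-mono (λ j → (1 ≤ᵇ j) ∧ (j ≤ᵇ n + W)) (_≤ᵇ W) i (n + c) c narrow)
              ∘ subst T (minus-shiftCell n (rect (n + W)) p q (i , c))
    where
    narrow : T ((1 ≤ᵇ n + c) ∧ (n + c ≤ᵇ n + W)) → T (c ≤ᵇ W)
    narrow h = subst T (≤ᵇ-+ n c W) (proj₂ (to (T-∧ {1 ≤ᵇ n + c}) h))
  N⊆R : ∀ y → T (rectMinus W p q y) → T (rectMinus (n + W) (shiftCell n p) (shiftCell n q) (shiftCell n y))
  N⊆R (i , c) = subst T (sym (minus-shiftCell n (rect (n + W)) p q (i , c)))
              ∘ minus-mono (rect W) (rect (n + W) ∘ shiftCell n) p q (i , c)
                  (strip-mono (λ j → (1 ≤ᵇ j) ∧ (j ≤ᵇ W)) (λ j → (1 ≤ᵇ j) ∧ (j ≤ᵇ n + W)) i c (n + c) shift)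
    where
    shift : T ((1 ≤ᵇ c) ∧ (c ≤ᵇ W)) → T ((1 ≤ᵇ n + c) ∧ (n + c ≤ᵇ n + W))
    shift h = let 1≤c , c≤W = to (T-∧ {1 ≤ᵇ c}) h
              in from T-∧ (≤⇒≤ᵇ (≤-trans (≤ᵇ⇒≤ 1 c 1≤c) (m≤n+m c n)) ,
                           subst T (sym (≤ᵇ-+ n c W)) c≤W)

-- Exceptional dominoes

MatchesPair : Cell → Cell → Cell × Cell → Set
MatchesPair p q d = (p ≡ proj₁ d × q ≡ proj₂ d) ⊎ (p ≡ proj₂ d × q ≡ proj₁ d)

-- The exceptional dominoes of the 4 × (3t+8) rectangle are those of the 4 × 8 one, with the cells
-- in columns ≥ 5 carried along by the right end of the rectangle.
stretch : ℕ → Cell → Cell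
stretch t (i , j) = i , (if j <ᵇ 5 then j else 3 * t + j)

stretchPair : ℕ → Cell × Cell → Cell × Cell
stretchPair t (c , d) = stretch t c , stretch t d

exceptional-stretch : ∀ t → exceptional t ≡ map (stretchPair t) (exceptional 0)
exceptional-stretch t = refl

stretch-suc : ∀ t c {i j} → 5 ≤ j → (i , j) ≡ stretch t c → (i , 3 + j) ≡ stretch (suc t) c
stretch-suc t (a , e) 5≤j eq with e <ᵇ 5 in e<5 | eq
... | true  | refl = ⊥-elim (<⇒≱ (<ᵇ⇒< e 5 (subst T (sym e<5) _)) 5≤j)
... | false | refl = cong (a ,_) (sym (cong (_+ e) (*-suc 3 t)))

stretch-fixed : ∀ t c → proj₂ c ≤ 4 → stretch t c ≡ c
stretch-fixed t (i , j) j≤4 rewrite to T-≡ (<⇒<ᵇ (s≤s j≤4)) = refl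

IsExceptional-suc : ∀ t i j k l → 5 ≤ j → 5 ≤ l →
                    IsExceptional t (i , j) (k , l) → IsExceptional (suc t) (i , 3 + j) (k , 3 + l)
IsExceptional-suc t i j k l 5≤j 5≤l exc =
  subst (Any (MatchesPair (i , 3 + j) (k , 3 + l))) (sym (exceptional-stretch (suc t)))
        (map⁺ {f = stretchPair (suc t)} {xs = exceptional 0}
              (Any.map (λ {d} → stretched {d}) (map⁻ {f = stretchPair t} {xs = exceptional 0}
                                       (subst (Any (MatchesPair (i , j) (k , l))) (exceptional-stretch t) exc))))
  where
  stretched : ∀ {d} → MatchesPair (i , j) (k , l) (stretchPair t d) →
                      MatchesPair (i , 3 + j) (k , 3 + l) (stretchPair (suc t) d)
  stretched {c , d} (inj₁ (p≡ , q≡)) = inj₁ (stretch-suc t c 5≤j p≡ , stretch-suc t d 5≤l q≡)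
  stretched {c , d} (inj₂ (p≡ , q≡)) = inj₂ (stretch-suc t d 5≤j p≡ , stretch-suc t c 5≤l q≡)

IsExceptional-atLeft : ∀ t p q → proj₂ p ≤ 4 → proj₂ q ≤ 4 → IsExceptional 0 p q → IsExceptional t p q
IsExceptional-atLeft t p q p≤4 q≤4 exc =
  subst (Any (MatchesPair p q)) (sym (exceptional-stretch t))
        (map⁺ {f = stretchPair t} {xs = exceptional 0} (Any.map (λ {d} → stretched {d}) exc))
  where
  stretched : ∀ {d} → MatchesPair p q d → MatchesPair p q (stretchPair t d)
  stretched (inj₁ (refl , refl)) = inj₁ (sym (stretch-fixed t p p≤4) , sym (stretch-fixed t q q≤4))
  stretched (inj₂ (refl , refl)) = inj₂ (sym (stretch-fixed t p p≤4) , sym (stretch-fixed t q q≤4))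

isExceptional? : ∀ t p q → Dec (IsExceptional t p q)
isExceptional? t p q =
  any? (λ d → (p ≟ᶜ proj₁ d ×-dec q ≟ᶜ proj₂ d) ⊎-dec (p ≟ᶜ proj₂ d ×-dec q ≟ᶜ proj₁ d)) (exceptional t)
  where
  _≟ᶜ_ : (x y : Cell) → Dec (x ≡ y)
  _≟ᶜ_ = ≡-dec _≟_ _≟_

columnCells : List ℕ → List Cell
columnCells = concatMap (λ j → map (_, j) (1 ∷ 2 ∷ 3 ∷ 4 ∷ []))

exceptional-obstructed : ∀ t →
  All (λ d → ¬ Tileable (rectMinus (3 * t + 8) (proj₁ d) (proj₂ d))) (exceptional t)
exceptional-obstructed t =
  atLeft  (2 , 1) (2 , 2) (1 ∷ []) _ ∷
  atLeft  (1 , 2) (2 , 2) (1 ∷ []) _ ∷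
  atRight (2 , 7) (2 , 8) (8 ∷ []) _ ∷
  atRight (1 , 7) (2 , 7) (8 ∷ []) _ ∷
  atLeft  (3 , 1) (3 , 2) (1 ∷ []) _ ∷
  atLeft  (3 , 2) (4 , 2) (1 ∷ []) _ ∷
  atRight (3 , 7) (3 , 8) (8 ∷ []) _ ∷
  atRight (3 , 7) (4 , 7) (8 ∷ []) _ ∷
  atLeft  (2 , 3) (3 , 3) (1 ∷ 2 ∷ []) _ ∷
  atRight (2 , 6) (3 , 6) (8 ∷ 7 ∷ []) _ ∷
  atLeft  (2 , 3) (2 , 4) (1 ∷ 2 ∷ 3 ∷ []) _ ∷
  atRight (2 , 5) (2 , 6) (8 ∷ 7 ∷ 6 ∷ []) _ ∷
  atLeft  (3 , 3) (3 , 4) (1 ∷ 2 ∷ 3 ∷ []) _ ∷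
  atRight (3 , 5) (3 , 6) (8 ∷ 7 ∷ 6 ∷ []) _ ∷
  []
  where
  atLeft : ∀ p q js → T (not (extendable (minus (strip (1 ≤ᵇ_)) p q) (rectMinus 8 p q) (columnCells js) [])) →
           ¬ Tileable (rectMinus (3 * t + 8) p q)
  atLeft p q js = untileable-atLeft (3 * t) p q (columnCells js)
  atRight : ∀ p q js → T (not (extendable (minus (strip (_≤ᵇ 8)) p q) (rectMinus 8 p q) (columnCells js) [])) →
            ¬ Tileable (rectMinus (3 * t + 8) (shiftCell (3 * t) p) (shiftCell (3 * t) q))
  atRight p q js = untileable-atRight (3 * t) p q (columnCells js)

untileable-matching : ∀ {m p q} d → ¬ Tileable (rectMinus m (proj₁ d) (proj₂ d)) → MatchesPair p q d →
                      ¬ Tileable (rectMinus m p q)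
untileable-matching d untileable (inj₁ (refl , refl)) = untileable
untileable-matching d untileable (inj₂ (refl , refl)) = untileable ∘ Tileable-resp (rectMinus-comm _ _ _)

exceptional-untileable : ∀ t p q → IsExceptional t p q → ¬ Tileable (rectMinus (3 * t + 8) p q)
exceptional-untileable t p q = All.lookupWith (λ {d} → untileable-matching d) (exceptional-obstructed t)

-- Dominoes in the first 8 columns

tilings4×8 : List ((Cell × Cell) × List Tromino)
tilings4×8 =
  (((1 , 1) , (1 , 2)) ,
      tromino (2 , 1) (# 2) ∷ tromino (3 , 1) (# 1) ∷ tromino (1 , 3) (# 1) ∷ tromino (3 , 3) (# 1) ∷ tromino (1 , 4) (# 2) ∷
      tromino (3 , 4) (# 2) ∷ tromino (1 , 6) (# 1) ∷ tromino (3 , 6) (# 1) ∷ tromino (1 , 7) (# 2) ∷ tromino (3 , 7) (# 2) ∷ []) ∷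
  (((1 , 1) , (2 , 1)) ,
      tromino (3 , 1) (# 1) ∷ tromino (1 , 2) (# 1) ∷ tromino (3 , 2) (# 2) ∷ tromino (1 , 3) (# 2) ∷ tromino (3 , 4) (# 1) ∷
      tromino (1 , 5) (# 3) ∷ tromino (3 , 5) (# 2) ∷ tromino (2 , 6) (# 2) ∷ tromino (1 , 7) (# 2) ∷ tromino (3 , 7) (# 0) ∷ []) ∷
  (((1 , 2) , (1 , 3)) ,
      tromino (1 , 1) (# 1) ∷ tromino (3 , 1) (# 1) ∷ tromino (2 , 2) (# 0) ∷ tromino (3 , 3) (# 0) ∷ tromino (1 , 4) (# 1) ∷
      tromino (1 , 5) (# 2) ∷ tromino (3 , 5) (# 1) ∷ tromino (2 , 6) (# 0) ∷ tromino (1 , 7) (# 2) ∷ tromino (3 , 7) (# 0) ∷ []) ∷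
  (((1 , 3) , (1 , 4)) ,
      tromino (1 , 1) (# 3) ∷ tromino (3 , 1) (# 1) ∷ tromino (2 , 2) (# 3) ∷ tromino (3 , 3) (# 1) ∷ tromino (1 , 4) (# 0) ∷
      tromino (3 , 4) (# 2) ∷ tromino (1 , 6) (# 1) ∷ tromino (3 , 6) (# 1) ∷ tromino (1 , 7) (# 2) ∷ tromino (3 , 7) (# 2) ∷ []) ∷
  (((1 , 3) , (2 , 3)) ,
      tromino (1 , 1) (# 3) ∷ tromino (3 , 1) (# 1) ∷ tromino (2 , 2) (# 1) ∷ tromino (3 , 3) (# 0) ∷ tromino (1 , 4) (# 1) ∷
      tromino (1 , 5) (# 2) ∷ tromino (3 , 5) (# 1) ∷ tromino (2 , 6) (# 0) ∷ tromino (1 , 7) (# 2) ∷ tromino (3 , 7) (# 0) ∷ []) ∷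
  (((1 , 4) , (1 , 5)) ,
      tromino (1 , 1) (# 1) ∷ tromino (3 , 1) (# 1) ∷ tromino (1 , 2) (# 2) ∷ tromino (3 , 2) (# 2) ∷ tromino (2 , 4) (# 2) ∷
      tromino (3 , 4) (# 1) ∷ tromino (1 , 6) (# 1) ∷ tromino (3 , 6) (# 1) ∷ tromino (1 , 7) (# 2) ∷ tromino (3 , 7) (# 2) ∷ []) ∷
  (((1 , 4) , (2 , 4)) ,
      tromino (1 , 1) (# 1) ∷ tromino (3 , 1) (# 1) ∷ tromino (1 , 2) (# 2) ∷ tromino (3 , 2) (# 2) ∷ tromino (3 , 4) (# 1) ∷
      tromino (1 , 5) (# 3) ∷ tromino (3 , 5) (# 2) ∷ tromino (2 , 6) (# 2) ∷ tromino (1 , 7) (# 2) ∷ tromino (3 , 7) (# 0) ∷ []) ∷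
  (((1 , 5) , (1 , 6)) ,
      tromino (1 , 1) (# 1) ∷ tromino (3 , 1) (# 1) ∷ tromino (1 , 2) (# 2) ∷ tromino (3 , 2) (# 2) ∷ tromino (1 , 4) (# 1) ∷
      tromino (3 , 4) (# 1) ∷ tromino (3 , 5) (# 2) ∷ tromino (2 , 6) (# 2) ∷ tromino (1 , 7) (# 2) ∷ tromino (3 , 7) (# 0) ∷ []) ∷
  (((1 , 5) , (2 , 5)) ,
      tromino (1 , 1) (# 3) ∷ tromino (3 , 1) (# 1) ∷ tromino (2 , 2) (# 3) ∷ tromino (1 , 3) (# 2) ∷ tromino (3 , 3) (# 1) ∷
      tromino (3 , 4) (# 2) ∷ tromino (1 , 6) (# 1) ∷ tromino (3 , 6) (# 1) ∷ tromino (1 , 7) (# 2) ∷ tromino (3 , 7) (# 2) ∷ []) ∷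
  (((1 , 6) , (1 , 7)) ,
      tromino (1 , 1) (# 1) ∷ tromino (3 , 1) (# 1) ∷ tromino (1 , 2) (# 2) ∷ tromino (3 , 2) (# 2) ∷ tromino (1 , 4) (# 3) ∷
      tromino (3 , 4) (# 1) ∷ tromino (2 , 5) (# 3) ∷ tromino (3 , 6) (# 1) ∷ tromino (1 , 7) (# 0) ∷ tromino (3 , 7) (# 2) ∷ []) ∷
  (((1 , 6) , (2 , 6)) ,
      tromino (1 , 1) (# 3) ∷ tromino (3 , 1) (# 1) ∷ tromino (2 , 2) (# 1) ∷ tromino (1 , 3) (# 1) ∷ tromino (3 , 3) (# 0) ∷
      tromino (1 , 4) (# 2) ∷ tromino (3 , 5) (# 1) ∷ tromino (2 , 6) (# 0) ∷ tromino (1 , 7) (# 2) ∷ tromino (3 , 7) (# 0) ∷ []) ∷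
  (((1 , 7) , (1 , 8)) ,
      tromino (1 , 1) (# 1) ∷ tromino (3 , 1) (# 1) ∷ tromino (1 , 2) (# 2) ∷ tromino (3 , 2) (# 2) ∷ tromino (1 , 4) (# 1) ∷
      tromino (3 , 4) (# 1) ∷ tromino (1 , 5) (# 2) ∷ tromino (3 , 5) (# 2) ∷ tromino (2 , 7) (# 2) ∷ tromino (3 , 7) (# 1) ∷ []) ∷
  (((1 , 8) , (2 , 8)) ,
      tromino (1 , 1) (# 1) ∷ tromino (3 , 1) (# 1) ∷ tromino (1 , 2) (# 2) ∷ tromino (3 , 2) (# 2) ∷ tromino (1 , 4) (# 3) ∷
      tromino (3 , 4) (# 1) ∷ tromino (2 , 5) (# 3) ∷ tromino (1 , 6) (# 2) ∷ tromino (3 , 6) (# 1) ∷ tromino (3 , 7) (# 2) ∷ []) ∷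
  (((2 , 1) , (3 , 1)) ,
      tromino (1 , 1) (# 2) ∷ tromino (3 , 1) (# 0) ∷ tromino (1 , 3) (# 1) ∷ tromino (3 , 3) (# 1) ∷ tromino (1 , 4) (# 2) ∷
      tromino (3 , 4) (# 2) ∷ tromino (1 , 6) (# 1) ∷ tromino (3 , 6) (# 1) ∷ tromino (1 , 7) (# 2) ∷ tromino (3 , 7) (# 2) ∷ []) ∷
  (((2 , 2) , (2 , 3)) ,
      tromino (1 , 1) (# 3) ∷ tromino (3 , 1) (# 1) ∷ tromino (3 , 2) (# 2) ∷ tromino (1 , 3) (# 2) ∷ tromino (3 , 4) (# 1) ∷
      tromino (1 , 5) (# 3) ∷ tromino (3 , 5) (# 2) ∷ tromino (2 , 6) (# 2) ∷ tromino (1 , 7) (# 2) ∷ tromino (3 , 7) (# 0) ∷ []) ∷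
  (((2 , 2) , (3 , 2)) ,
      tromino (1 , 1) (# 3) ∷ tromino (3 , 1) (# 1) ∷ tromino (1 , 3) (# 1) ∷ tromino (3 , 3) (# 1) ∷ tromino (1 , 4) (# 2) ∷
      tromino (3 , 4) (# 2) ∷ tromino (1 , 6) (# 1) ∷ tromino (3 , 6) (# 1) ∷ tromino (1 , 7) (# 2) ∷ tromino (3 , 7) (# 2) ∷ []) ∷
  (((2 , 4) , (2 , 5)) ,
      tromino (1 , 1) (# 3) ∷ tromino (3 , 1) (# 1) ∷ tromino (2 , 2) (# 1) ∷ tromino (1 , 3) (# 3) ∷ tromino (3 , 3) (# 0) ∷
      tromino (1 , 5) (# 2) ∷ tromino (3 , 5) (# 1) ∷ tromino (2 , 6) (# 0) ∷ tromino (1 , 7) (# 2) ∷ tromino (3 , 7) (# 0) ∷ []) ∷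
  (((2 , 4) , (3 , 4)) ,
      tromino (1 , 1) (# 1) ∷ tromino (3 , 1) (# 1) ∷ tromino (1 , 2) (# 2) ∷ tromino (3 , 2) (# 2) ∷ tromino (1 , 4) (# 2) ∷
      tromino (3 , 4) (# 0) ∷ tromino (1 , 6) (# 1) ∷ tromino (3 , 6) (# 1) ∷ tromino (1 , 7) (# 2) ∷ tromino (3 , 7) (# 2) ∷ []) ∷
  (((2 , 5) , (3 , 5)) ,
      tromino (1 , 1) (# 1) ∷ tromino (3 , 1) (# 1) ∷ tromino (1 , 2) (# 2) ∷ tromino (3 , 2) (# 2) ∷ tromino (1 , 4) (# 3) ∷
      tromino (3 , 4) (# 1) ∷ tromino (1 , 6) (# 1) ∷ tromino (3 , 6) (# 1) ∷ tromino (1 , 7) (# 2) ∷ tromino (3 , 7) (# 2) ∷ []) ∷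
  (((2 , 6) , (2 , 7)) ,
      tromino (1 , 1) (# 3) ∷ tromino (3 , 1) (# 1) ∷ tromino (2 , 2) (# 3) ∷ tromino (1 , 3) (# 2) ∷ tromino (3 , 3) (# 1) ∷
      tromino (3 , 4) (# 2) ∷ tromino (1 , 5) (# 3) ∷ tromino (3 , 6) (# 1) ∷ tromino (1 , 7) (# 2) ∷ tromino (3 , 7) (# 2) ∷ []) ∷
  (((2 , 7) , (3 , 7)) ,
      tromino (1 , 1) (# 1) ∷ tromino (3 , 1) (# 1) ∷ tromino (1 , 2) (# 2) ∷ tromino (3 , 2) (# 2) ∷ tromino (1 , 4) (# 1) ∷
      tromino (3 , 4) (# 1) ∷ tromino (1 , 5) (# 2) ∷ tromino (3 , 5) (# 2) ∷ tromino (1 , 7) (# 2) ∷ tromino (3 , 7) (# 0) ∷ []) ∷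
  (((2 , 8) , (3 , 8)) ,
      tromino (1 , 1) (# 1) ∷ tromino (3 , 1) (# 1) ∷ tromino (1 , 2) (# 2) ∷ tromino (3 , 2) (# 2) ∷ tromino (1 , 4) (# 1) ∷
      tromino (3 , 4) (# 1) ∷ tromino (1 , 5) (# 2) ∷ tromino (3 , 5) (# 2) ∷ tromino (1 , 7) (# 3) ∷ tromino (3 , 7) (# 1) ∷ []) ∷
  (((3 , 1) , (4 , 1)) ,
      tromino (1 , 1) (# 1) ∷ tromino (1 , 2) (# 2) ∷ tromino (3 , 2) (# 1) ∷ tromino (2 , 3) (# 0) ∷ tromino (1 , 4) (# 2) ∷
      tromino (3 , 4) (# 0) ∷ tromino (1 , 6) (# 1) ∷ tromino (3 , 6) (# 1) ∷ tromino (1 , 7) (# 2) ∷ tromino (3 , 7) (# 2) ∷ []) ∷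
  (((3 , 2) , (3 , 3)) ,
      tromino (1 , 1) (# 1) ∷ tromino (3 , 1) (# 1) ∷ tromino (1 , 2) (# 2) ∷ tromino (3 , 3) (# 0) ∷ tromino (1 , 4) (# 1) ∷
      tromino (1 , 5) (# 2) ∷ tromino (3 , 5) (# 1) ∷ tromino (2 , 6) (# 0) ∷ tromino (1 , 7) (# 2) ∷ tromino (3 , 7) (# 0) ∷ []) ∷
  (((3 , 3) , (4 , 3)) ,
      tromino (1 , 1) (# 3) ∷ tromino (3 , 1) (# 1) ∷ tromino (2 , 2) (# 3) ∷ tromino (1 , 3) (# 2) ∷ tromino (3 , 4) (# 1) ∷
      tromino (1 , 5) (# 3) ∷ tromino (3 , 5) (# 2) ∷ tromino (2 , 6) (# 2) ∷ tromino (1 , 7) (# 2) ∷ tromino (3 , 7) (# 0) ∷ []) ∷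
  (((3 , 4) , (3 , 5)) ,
      tromino (1 , 1) (# 3) ∷ tromino (3 , 1) (# 1) ∷ tromino (2 , 2) (# 3) ∷ tromino (1 , 3) (# 2) ∷ tromino (3 , 3) (# 1) ∷
      tromino (1 , 5) (# 3) ∷ tromino (3 , 5) (# 0) ∷ tromino (2 , 6) (# 2) ∷ tromino (1 , 7) (# 2) ∷ tromino (3 , 7) (# 0) ∷ []) ∷
  (((3 , 4) , (4 , 4)) ,
      tromino (1 , 1) (# 1) ∷ tromino (3 , 1) (# 1) ∷ tromino (1 , 2) (# 2) ∷ tromino (3 , 2) (# 2) ∷ tromino (1 , 4) (# 1) ∷
      tromino (1 , 5) (# 2) ∷ tromino (3 , 5) (# 1) ∷ tromino (2 , 6) (# 0) ∷ tromino (1 , 7) (# 2) ∷ tromino (3 , 7) (# 0) ∷ []) ∷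
  (((3 , 5) , (4 , 5)) ,
      tromino (1 , 1) (# 3) ∷ tromino (3 , 1) (# 1) ∷ tromino (2 , 2) (# 1) ∷ tromino (1 , 3) (# 1) ∷ tromino (3 , 3) (# 0) ∷
      tromino (1 , 4) (# 2) ∷ tromino (1 , 6) (# 1) ∷ tromino (3 , 6) (# 1) ∷ tromino (1 , 7) (# 2) ∷ tromino (3 , 7) (# 2) ∷ []) ∷
  (((3 , 6) , (3 , 7)) ,
      tromino (1 , 1) (# 3) ∷ tromino (3 , 1) (# 1) ∷ tromino (2 , 2) (# 1) ∷ tromino (1 , 3) (# 1) ∷ tromino (3 , 3) (# 0) ∷
      tromino (1 , 4) (# 2) ∷ tromino (3 , 5) (# 1) ∷ tromino (1 , 6) (# 1) ∷ tromino (1 , 7) (# 2) ∷ tromino (3 , 7) (# 0) ∷ []) ∷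
  (((3 , 6) , (4 , 6)) ,
      tromino (1 , 1) (# 3) ∷ tromino (3 , 1) (# 1) ∷ tromino (2 , 2) (# 3) ∷ tromino (1 , 3) (# 2) ∷ tromino (3 , 3) (# 1) ∷
      tromino (3 , 4) (# 2) ∷ tromino (1 , 5) (# 3) ∷ tromino (2 , 6) (# 2) ∷ tromino (1 , 7) (# 2) ∷ tromino (3 , 7) (# 0) ∷ []) ∷
  (((3 , 8) , (4 , 8)) ,
      tromino (1 , 1) (# 1) ∷ tromino (3 , 1) (# 1) ∷ tromino (1 , 2) (# 2) ∷ tromino (3 , 2) (# 2) ∷ tromino (1 , 4) (# 3) ∷
      tromino (3 , 4) (# 1) ∷ tromino (2 , 5) (# 1) ∷ tromino (1 , 6) (# 1) ∷ tromino (3 , 6) (# 0) ∷ tromino (1 , 7) (# 2) ∷ []) ∷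
  (((4 , 1) , (4 , 2)) ,
      tromino (1 , 1) (# 2) ∷ tromino (2 , 1) (# 1) ∷ tromino (1 , 3) (# 1) ∷ tromino (3 , 3) (# 1) ∷ tromino (1 , 4) (# 2) ∷
      tromino (3 , 4) (# 2) ∷ tromino (1 , 6) (# 1) ∷ tromino (3 , 6) (# 1) ∷ tromino (1 , 7) (# 2) ∷ tromino (3 , 7) (# 2) ∷ []) ∷
  (((4 , 2) , (4 , 3)) ,
      tromino (1 , 1) (# 1) ∷ tromino (3 , 1) (# 3) ∷ tromino (1 , 2) (# 2) ∷ tromino (2 , 3) (# 0) ∷ tromino (1 , 4) (# 2) ∷
      tromino (3 , 4) (# 0) ∷ tromino (1 , 6) (# 1) ∷ tromino (3 , 6) (# 1) ∷ tromino (1 , 7) (# 2) ∷ tromino (3 , 7) (# 2) ∷ []) ∷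
  (((4 , 3) , (4 , 4)) ,
      tromino (1 , 1) (# 3) ∷ tromino (3 , 1) (# 1) ∷ tromino (2 , 2) (# 1) ∷ tromino (1 , 3) (# 1) ∷ tromino (1 , 4) (# 2) ∷
      tromino (3 , 4) (# 2) ∷ tromino (1 , 6) (# 1) ∷ tromino (3 , 6) (# 1) ∷ tromino (1 , 7) (# 2) ∷ tromino (3 , 7) (# 2) ∷ []) ∷
  (((4 , 4) , (4 , 5)) ,
      tromino (1 , 1) (# 1) ∷ tromino (3 , 1) (# 1) ∷ tromino (1 , 2) (# 2) ∷ tromino (3 , 2) (# 2) ∷ tromino (1 , 4) (# 2) ∷
      tromino (2 , 4) (# 1) ∷ tromino (1 , 6) (# 1) ∷ tromino (3 , 6) (# 1) ∷ tromino (1 , 7) (# 2) ∷ tromino (3 , 7) (# 2) ∷ []) ∷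
  (((4 , 5) , (4 , 6)) ,
      tromino (1 , 1) (# 1) ∷ tromino (3 , 1) (# 1) ∷ tromino (1 , 2) (# 2) ∷ tromino (3 , 2) (# 2) ∷ tromino (1 , 4) (# 1) ∷
      tromino (3 , 4) (# 3) ∷ tromino (1 , 5) (# 2) ∷ tromino (2 , 6) (# 0) ∷ tromino (1 , 7) (# 2) ∷ tromino (3 , 7) (# 0) ∷ []) ∷
  (((4 , 6) , (4 , 7)) ,
      tromino (1 , 1) (# 1) ∷ tromino (3 , 1) (# 1) ∷ tromino (1 , 2) (# 2) ∷ tromino (3 , 2) (# 2) ∷ tromino (1 , 4) (# 3) ∷
      tromino (3 , 4) (# 1) ∷ tromino (2 , 5) (# 1) ∷ tromino (1 , 6) (# 1) ∷ tromino (1 , 7) (# 2) ∷ tromino (3 , 7) (# 2) ∷ []) ∷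
  (((4 , 7) , (4 , 8)) ,
      tromino (1 , 1) (# 1) ∷ tromino (3 , 1) (# 1) ∷ tromino (1 , 2) (# 2) ∷ tromino (3 , 2) (# 2) ∷ tromino (1 , 4) (# 1) ∷
      tromino (3 , 4) (# 1) ∷ tromino (1 , 5) (# 2) ∷ tromino (3 , 5) (# 2) ∷ tromino (1 , 7) (# 2) ∷ tromino (2 , 7) (# 1) ∷ []) ∷
  []

tilings4×11 : List ((Cell × Cell) × List Tromino)
tilings4×11 =
  (((2 , 7) , (2 , 8)) ,
      tromino (1 , 1) (# 1) ∷ tromino (3 , 1) (# 1) ∷ tromino (1 , 2) (# 2) ∷ tromino (3 , 2) (# 2) ∷ tromino (1 , 4) (# 3) ∷
      tromino (3 , 4) (# 1) ∷ tromino (2 , 5) (# 1) ∷ tromino (1 , 6) (# 3) ∷ tromino (3 , 6) (# 0) ∷ tromino (1 , 8) (# 2) ∷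
      tromino (3 , 8) (# 1) ∷ tromino (2 , 9) (# 0) ∷ tromino (1 , 10) (# 2) ∷ tromino (3 , 10) (# 0) ∷ []) ∷
  (((1 , 7) , (2 , 7)) ,
      tromino (1 , 1) (# 1) ∷ tromino (3 , 1) (# 1) ∷ tromino (1 , 2) (# 2) ∷ tromino (3 , 2) (# 2) ∷ tromino (1 , 4) (# 1) ∷
      tromino (3 , 4) (# 1) ∷ tromino (1 , 5) (# 2) ∷ tromino (3 , 5) (# 2) ∷ tromino (3 , 7) (# 1) ∷ tromino (1 , 8) (# 3) ∷
      tromino (3 , 8) (# 2) ∷ tromino (2 , 9) (# 2) ∷ tromino (1 , 10) (# 2) ∷ tromino (3 , 10) (# 0) ∷ []) ∷
  (((3 , 7) , (3 , 8)) ,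
      tromino (1 , 1) (# 1) ∷ tromino (3 , 1) (# 1) ∷ tromino (1 , 2) (# 2) ∷ tromino (3 , 2) (# 2) ∷ tromino (1 , 4) (# 3) ∷
      tromino (3 , 4) (# 1) ∷ tromino (2 , 5) (# 3) ∷ tromino (1 , 6) (# 2) ∷ tromino (3 , 6) (# 1) ∷ tromino (1 , 8) (# 3) ∷
      tromino (3 , 8) (# 0) ∷ tromino (2 , 9) (# 2) ∷ tromino (1 , 10) (# 2) ∷ tromino (3 , 10) (# 0) ∷ []) ∷
  (((3 , 7) , (4 , 7)) ,
      tromino (1 , 1) (# 1) ∷ tromino (3 , 1) (# 1) ∷ tromino (1 , 2) (# 2) ∷ tromino (3 , 2) (# 2) ∷ tromino (1 , 4) (# 1) ∷
      tromino (3 , 4) (# 1) ∷ tromino (1 , 5) (# 2) ∷ tromino (3 , 5) (# 2) ∷ tromino (1 , 7) (# 1) ∷ tromino (1 , 8) (# 2) ∷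
      tromino (3 , 8) (# 1) ∷ tromino (2 , 9) (# 0) ∷ tromino (1 , 10) (# 2) ∷ tromino (3 , 10) (# 0) ∷ []) ∷
  (((2 , 6) , (3 , 6)) ,
      tromino (1 , 1) (# 3) ∷ tromino (3 , 1) (# 1) ∷ tromino (2 , 2) (# 1) ∷ tromino (1 , 3) (# 1) ∷ tromino (3 , 3) (# 0) ∷
      tromino (1 , 4) (# 2) ∷ tromino (3 , 5) (# 1) ∷ tromino (1 , 6) (# 2) ∷ tromino (3 , 7) (# 1) ∷ tromino (1 , 8) (# 3) ∷
      tromino (3 , 8) (# 2) ∷ tromino (2 , 9) (# 2) ∷ tromino (1 , 10) (# 2) ∷ tromino (3 , 10) (# 0) ∷ []) ∷
  (((2 , 5) , (2 , 6)) ,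
      tromino (1 , 1) (# 1) ∷ tromino (3 , 1) (# 1) ∷ tromino (1 , 2) (# 2) ∷ tromino (3 , 2) (# 2) ∷ tromino (1 , 4) (# 3) ∷
      tromino (3 , 4) (# 1) ∷ tromino (3 , 5) (# 2) ∷ tromino (1 , 6) (# 2) ∷ tromino (3 , 7) (# 1) ∷ tromino (1 , 8) (# 3) ∷
      tromino (3 , 8) (# 2) ∷ tromino (2 , 9) (# 2) ∷ tromino (1 , 10) (# 2) ∷ tromino (3 , 10) (# 0) ∷ []) ∷
  (((3 , 5) , (3 , 6)) ,
      tromino (1 , 1) (# 1) ∷ tromino (3 , 1) (# 1) ∷ tromino (1 , 2) (# 2) ∷ tromino (3 , 2) (# 2) ∷ tromino (1 , 4) (# 1) ∷
      tromino (3 , 4) (# 1) ∷ tromino (1 , 5) (# 2) ∷ tromino (3 , 6) (# 0) ∷ tromino (1 , 7) (# 1) ∷ tromino (1 , 8) (# 2) ∷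
      tromino (3 , 8) (# 1) ∷ tromino (2 , 9) (# 0) ∷ tromino (1 , 10) (# 2) ∷ tromino (3 , 10) (# 0) ∷ []) ∷
  []

tilingFor : List ((Cell × Cell) × List Tromino) → Cell → Cell → List Tromino
tilingFor []                        p q = []
tilingFor (((a , b) , ts) ∷ table) p q =
  if (p ==ᶜ a ∧ q ==ᶜ b) ∨ (p ==ᶜ b ∧ q ==ᶜ a) then ts else tilingFor table p q

tiledBy : ℕ → List ((Cell × Cell) × List Tromino) → Cell → Cell → Bool
tiledBy W table p q = checkTiling 4 W (rectMinus W p q) (tilingFor table p q)

tiledBy-sound : ∀ W table p q → tiledBy W table p q ≡ true → Tileable (rectMinus W p q)
tiledBy-sound W table p q ok =
  tilingFor table p q ,
  checkTiling-sound (tilingFor table p q) (from T-≡ ok) (λ {i} {j} → rect-inBox ∘ rectMinus⇒rect W p q (i , j))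

neighbours : Cell → List Cell
neighbours (i , j) = (i , suc j) ∷ (i , pred j) ∷ (suc i , j) ∷ (pred i , j) ∷ []

adjacent⇒neighbour : ∀ {p q} → Adjacent p q → q ∈ neighbours p
adjacent⇒neighbour (inj₁ (refl , refl))                = here refl
adjacent⇒neighbour (inj₂ (inj₁ (refl , refl)))         = there (here refl)
adjacent⇒neighbour (inj₂ (inj₂ (inj₁ (refl , refl))))  = there (there (here refl))
adjacent⇒neighbour (inj₂ (inj₂ (inj₂ (refl , refl))))  = there (there (there (here refl)))

all-true-∈ : ∀ {A : Set} (f : A → Bool) {xs x} → all f xs ≡ true → x ∈ xs → f x ≡ true
all-true-∈ f {y ∷ _} allTrue (here refl)  = ∧-conicalˡ (f y) _ allTrue
all-true-∈ f {y ∷ _} allTrue (there x∈xs) = all-true-∈ f (∧-conicalʳ (f y) _ allTrue) x∈xs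

classifiedAt : Cell → Cell → Bool
classifiedAt p q =
  not (rect 8 p ∧ rect 8 q) ∨
  tiledBy 8 tilings4×8 p q ∨ ⌊ isExceptional? 0 p q ⌋ ∧ ((proj₂ p ≤ᵇ 4) ∧ (proj₂ q ≤ᵇ 4) ∨ tiledBy 11 tilings4×11 p q)

-- Stated with ≡ true rather than T: Agda compares T b with T b by evaluating b, and b is the whole
-- case check.  For the same reason the implicit arguments below are all given explicitly.
dominoes4×8-classified : all (λ p → all (classifiedAt p) (neighbours p)) (boxCells 4 8) ≡ true
dominoes4×8-classified = refl

verdict-cases : ∀ a e c d w → a ∨ e ∧ (c ∧ d ∨ w) ≡ true →
                a ≡ true ⊎ e ≡ true × (c ≡ true × d ≡ true ⊎ w ≡ true)
verdict-cases true  e     c     d     w     _    = inj₁ refl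
verdict-cases false true  true  true  w     _    = inj₂ (refl , inj₁ (refl , refl))
verdict-cases false true  true  false w     w≡tt = inj₂ (refl , inj₂ w≡tt)
verdict-cases false true  false d     w     w≡tt = inj₂ (refl , inj₂ w≡tt)
verdict-cases false false c     d     w     ()

witness : ∀ {A : Set} (a? : Dec A) → ⌊ a? ⌋ ≡ true → A
witness (yes a) _ = a

NearLeftCase : Cell → Cell → Set
NearLeftCase p q =
  tiledBy 8 tilings4×8 p q ≡ true ⊎
  IsExceptional 0 p q × (proj₂ p ≤ 4 × proj₂ q ≤ 4 ⊎ tiledBy 11 tilings4×11 p q ≡ true)

domino4×8-classified : ∀ {p q} → InRect 8 p → InRect 8 q → Adjacent p q → NearLeftCase p q
domino4×8-classified {i , j} {q} inP@((_ , i≤4) , (_ , j≤8)) inQ adj =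
  Sum.map₂ (Product.map (witness (isExceptional? 0 (i , j) q)) (Sum.map₁ (Product.map ≤4 ≤4)))
    (verdict-cases (tiledBy 8 tilings4×8 (i , j) q) ⌊ isExceptional? 0 (i , j) q ⌋ (j ≤ᵇ 4) (proj₂ q ≤ᵇ 4)
                   (tiledBy 11 tilings4×11 (i , j) q)
      (implied {rect 8 (i , j) ∧ rect 8 q} (to T-≡ (from T-∧ (InRect⇒rect inP , InRect⇒rect inQ)))
               (all-true-∈ (classifiedAt (i , j)) {neighbours (i , j)} {q}
                           (all-true-∈ (λ p → all (classifiedAt p) (neighbours p)) {boxCells 4 8} {i , j}
                                       dominoes4×8-classified (∈-boxCells i≤4 j≤8))
                           (adjacent⇒neighbour adj))))
  where
  implied : ∀ {b v} → b ≡ true → not b ∨ v ≡ true → v ≡ true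
  implied refl v≡tt = v≡tt
  ≤4 : ∀ {n} → (n ≤ᵇ 4) ≡ true → n ≤ 4
  ≤4 {n} h = ≤ᵇ⇒≤ n 4 (from T-≡ h)

3*suc+8 : ∀ t → 3 * suc t + 8 ≡ 3 + (3 * t + 8)
3*suc+8 t = cong (_+ 8) (*-suc 3 t)

tileable-nearLeft : ∀ t p q → InRect 8 p → InRect 8 q → ¬ IsExceptional t p q → NearLeftCase p q →
                    Tileable (rectMinus (3 * t + 8) p q)
tileable-nearLeft t p q inP inQ _ (inj₁ tiled₈) =
  subst (λ m → Tileable (rectMinus m p q)) (+-comm 8 (3 * t))
        (Tileable-extendʳ (proj₂ (proj₂ inP)) (proj₂ (proj₂ inQ)) (tiledBy-sound 8 tilings4×8 p q tiled₈)
                          (rect-3*-tileable t))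
tileable-nearLeft t p q _ _ ¬exc (inj₂ (exc₀ , inj₁ (p≤4 , q≤4))) =
  ⊥-elim (¬exc (IsExceptional-atLeft t p q p≤4 q≤4 exc₀))
tileable-nearLeft zero p q _ _ ¬exc (inj₂ (exc₀ , inj₂ _)) = ⊥-elim (¬exc exc₀)
tileable-nearLeft (suc t) p q inP inQ _ (inj₂ (_ , inj₂ tiled₁₁)) =
  subst (λ m → Tileable (rectMinus m p q)) (trans (cong (3 +_) (+-comm 8 (3 * t))) (sym (3*suc+8 t)))
        (Tileable-extendʳ (≤-trans (proj₂ (proj₂ inP)) (m≤n+m 8 3)) (≤-trans (proj₂ (proj₂ inQ)) (m≤n+m 8 3))
                          (tiledBy-sound 11 tilings4×11 p q tiled₁₁) (rect-3*-tileable t))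

-- Induction on t

Adjacent-shiftCell : ∀ a {i j k l} → Adjacent (i , a + j) (k , a + l) → Adjacent (i , j) (k , l)
Adjacent-shiftCell a {j = j} (inj₁ (i≡k , eq)) =
  inj₁ (i≡k , +-cancelˡ-≡ a _ _ (trans (+-suc a j) eq))
Adjacent-shiftCell a {l = l} (inj₂ (inj₁ (i≡k , eq))) =
  inj₂ (inj₁ (i≡k , +-cancelˡ-≡ a _ _ (trans (+-suc a l) eq)))
Adjacent-shiftCell a (inj₂ (inj₂ (inj₁ (eq , i+1≡k)))) =
  inj₂ (inj₂ (inj₁ (+-cancelˡ-≡ a _ _ eq , i+1≡k)))
Adjacent-shiftCell a (inj₂ (inj₂ (inj₂ (eq , k+1≡i)))) =
  inj₂ (inj₂ (inj₂ (+-cancelˡ-≡ a _ _ eq , k+1≡i)))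

adjacent-columns : ∀ {i j k l} → Adjacent (i , j) (k , l) → j ≤ suc l × l ≤ suc j
adjacent-columns (inj₁ (_ , refl))               = m≤n⇒m≤1+n (n≤1+n _) , ≤-refl
adjacent-columns (inj₂ (inj₁ (_ , refl)))        = ≤-refl , m≤n⇒m≤1+n (n≤1+n _)
adjacent-columns (inj₂ (inj₂ (inj₁ (refl , _)))) = n≤1+n _ , n≤1+n _
adjacent-columns (inj₂ (inj₂ (inj₂ (refl , _)))) = n≤1+n _ , n≤1+n _

beyondColumn8 : ∀ {i j k l} → Adjacent (i , j) (k , l) → ¬ (j ≤ 8 × l ≤ 8) → 8 ≤ j × 8 ≤ l
beyondColumn8 {j = j} {l = l} adj ¬near with adjacent-columns adj | j ≤? 8 | l ≤? 8
... | _        | yes j≤8 | yes l≤8 = ⊥-elim (¬near (j≤8 , l≤8))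
... | j≤l+1 , _ | no j≰8 | _      = ≤-pred (m≤n⇒m≤1+n (≰⇒> j≰8)) , ≤-pred (≤-trans (≰⇒> j≰8) j≤l+1)
... | _ , l≤j+1 | yes _  | no l≰8 = ≤-pred (≤-trans (≰⇒> l≰8) l≤j+1) , ≤-pred (m≤n⇒m≤1+n (≰⇒> l≰8))

UnexceptionalTileable : ℕ → Set
UnexceptionalTileable t = ∀ p q → InRect (3 * t + 8) p → InRect (3 * t + 8) q → Adjacent p q →
                          ¬ IsExceptional t p q → Tileable (rectMinus (3 * t + 8) p q)

tileable-pastColumn8 : ∀ t {i j k l} → 8 ≤ j → 8 ≤ l →
  InRect (3 * suc t + 8) (i , j) → InRect (3 * suc t + 8) (k , l) → Adjacent (i , j) (k , l) →
  ¬ IsExceptional (suc t) (i , j) (k , l) → UnexceptionalTileable t →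
  Tileable (rectMinus (3 * suc t + 8) (i , j) (k , l))
tileable-pastColumn8 t {i} {suc (suc (suc j))} {k} {suc (suc (suc l))}
                     (s≤s (s≤s (s≤s 5≤j))) (s≤s (s≤s (s≤s 5≤l))) inP inQ adj ¬exc tileable-t =
  subst (λ m → Tileable (rectMinus m (i , 3 + j) (k , 3 + l))) (sym (3*suc+8 t))
    (Tileable-extendˡ 1≤j 1≤l (rect-3*-tileable 1)
      (tileable-t (i , j) (k , l) (unshift 1≤j inP) (unshift 1≤l inQ) (Adjacent-shiftCell 3 adj)
                  (¬exc ∘ IsExceptional-suc t i j k l 5≤j 5≤l)))
  where
  1≤j : 1 ≤ j
  1≤j = ≤-trans (s≤s z≤n) 5≤j
  1≤l : 1 ≤ l
  1≤l = ≤-trans (s≤s z≤n) 5≤l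
  unshift : ∀ {r c} → 1 ≤ c → InRect (3 * suc t + 8) (r , 3 + c) → InRect (3 * t + 8) (r , c)
  unshift {c = c} 1≤c (rows , _ , 3+c≤) =
    rows , 1≤c , +-cancelˡ-≤ 3 c _ (subst (3 + c ≤_) (3*suc+8 t) 3+c≤)

tileable : ∀ t → UnexceptionalTileable t
tileable zero p q inP inQ adj ¬exc = tileable-nearLeft 0 p q inP inQ ¬exc (domino4×8-classified inP inQ adj)
tileable (suc t) (i , j) (k , l) inP inQ adj ¬exc with j ≤? 8 ×-dec l ≤? 8
... | yes (j≤8 , l≤8) =
  tileable-nearLeft (suc t) _ _ inP′ inQ′ ¬exc (domino4×8-classified inP′ inQ′ adj)
  where
  narrow : ∀ {r c} → InRect (3 * suc t + 8) (r , c) → c ≤ 8 → InRect 8 (r , c)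
  narrow (rows , 1≤c , _) c≤8 = rows , 1≤c , c≤8
  inP′ : InRect 8 (i , j)
  inP′ = narrow inP j≤8
  inQ′ : InRect 8 (k , l)
  inQ′ = narrow inQ l≤8
... | no ¬near =
  let 8≤j , 8≤l = beyondColumn8 adj ¬near in tileable-pastColumn8 t 8≤j 8≤l inP inQ adj ¬exc (tileable t)

theorem6 : (t : ℕ) (p q : Cell) →
    InRect (3 * t + 8) p → InRect (3 * t + 8) q → Adjacent p q →
    (¬ Tileable (rectMinus (3 * t + 8) p q)) ⇔ IsExceptional t p q
theorem6 t p q inP inQ adj =
  mk⇔ (λ untileable → decidable-stable (isExceptional? t p q) (untileable ∘ tileable t p q inP inQ adj))
      (exceptional-untileable t p q)
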